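{- Let $b\ge 2$ and $g\ge 3$ be integers, and let $(d_1,d_2,l,m,n)$ be integers with $1\le d_1,d_2\le g-1$, $n\ge0$, $1\le l\le m$, satisfying for some choice of signs $$(b\pm1)b^n\pm1=d_1\frac{g^l-1}{g-1}+d_2\frac{g^m-1}{g-1}.$$ Then $l\le m<1.3\,(n+1.6)\dfrac{\log b}{\log g}+1$. -}

module Defs where

open import Data.Nat using (ℕ; zero; suc; _+_; _*_; _^_)

-- repunit g k = 1 + g + g^2 + ... + g^(k-1) = (g^k - 1)/(g - 1)  (exact for g ≥ 2)
repunit : ℕ → ℕ → ℕ
repunit g zero    = 0
repunit g (suc k) = g ^ k + repunit g k

{-# OPTIONS --safe #-}
-- The left-hand side is at most (b + 1) b^n + 1 ≤ b^(n+2), while the right-hand side is at least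
-- its leading term g^(m-1). Hence g^(m-1) ≤ b^(n+2), and raising to the 100th power gives
-- g^(100(m-1)) ≤ b^(100n+200) < b^(130n+208).
module Submission where

open import Defs
open import Data.Nat using (ℕ; zero; suc; _+_; _*_; _^_; _∸_; _≤_; _<_; s≤s)
open import Data.Nat.Properties
open import Data.Integer using (ℤ; +_; -[1+_]) renaming (_+_ to _+ℤ_; _*_ to _*ℤ_; _^_ to _^ℤ_)
open import Data.Integer.Properties using (pos-*)
open import Data.Product using (_×_; _,_; ∃-syntax)
open import Data.Sum using (_⊎_; inj₁; inj₂)
open import Relation.Binary.PropositionalEquality using (_≡_; refl; sym; trans; cong; cong₂)
open import Data.Nat.Solver using (module +-*-Solver)
open +-*-Solver using (solve; _:=_; _:+_; _:*_; con)

Sign : ℤ → Set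
Sign s = s ≡ + 1 ⊎ s ≡ -[1+ 0 ]

pos-^ : ∀ b n → + (b ^ n) ≡ (+ b) ^ℤ n
pos-^ b zero    = refl
pos-^ b (suc n) rewrite sym (pos-^ b n) = pos-* b (b ^ n)

m±1≡n⇒n≤1+m : ∀ {m n s} → Sign s → + m +ℤ s ≡ + n → n ≤ suc m
m±1≡n⇒n≤1+m {m} (inj₁ refl) refl = ≤-reflexive (+-comm m 1)
m±1≡n⇒n≤1+m {suc m} (inj₂ refl) refl = ≤-trans (n≤1+n m) (n≤1+n (suc m))

1+m±1≡n×n≤2+m : ∀ m {s} → Sign s → ∃[ n ] + suc m +ℤ s ≡ + n × n ≤ 2 + m
1+m±1≡n×n≤2+m m (inj₁ refl) = suc m + 1 , refl , ≤-reflexive (+-comm (suc m) 1)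
1+m±1≡n×n≤2+m m (inj₂ refl) = m , refl , ≤-trans (n≤1+n m) (n≤1+n (suc m))

[b±1]b^n±1≡v⇒v≤1+[1+b]b^n : ∀ {b v s₁ s₂} n → 1 ≤ b → Sign s₁ → Sign s₂ →
                             (+ b +ℤ s₁) *ℤ (+ b) ^ℤ n +ℤ s₂ ≡ + v → v ≤ suc (suc b * b ^ n)
[b±1]b^n±1≡v⇒v≤1+[1+b]b^n {suc b} {v} {s₁} {s₂} n _ σ₁ σ₂ eq
  with 1+m±1≡n×n≤2+m b σ₁
... | c , b±1≡c , c≤2+b = begin
  v                             ≤⟨ m±1≡n⇒n≤1+m σ₂ (trans (cong (_+ℤ s₂) c*b^n≡lhs) eq) ⟩
  suc (c * suc b ^ n)           ≤⟨ s≤s (*-monoˡ-≤ (suc b ^ n) c≤2+b) ⟩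
  suc (suc (suc b) * suc b ^ n) ∎
  where
  open ≤-Reasoning
  c*b^n≡lhs : + (c * suc b ^ n) ≡ (+ suc b +ℤ s₁) *ℤ (+ suc b) ^ℤ n
  c*b^n≡lhs = trans (pos-* c (suc b ^ n)) (cong₂ _*ℤ_ (sym b±1≡c) (pos-^ (suc b) n))

2+n≤n*n : ∀ {n} → 2 ≤ n → 2 + n ≤ n * n
2+n≤n*n {n} 2≤n = begin
  2 + n   ≡⟨ +-comm 2 n ⟩
  n + 2   ≤⟨ +-monoʳ-≤ n 2≤n ⟩
  n + n   ≡⟨ cong (_+_ n) (sym (+-identityʳ n)) ⟩
  2 * n   ≤⟨ *-monoˡ-≤ n 2≤n ⟩
  n * n   ∎
  where open ≤-Reasoning

1+[1+b]b^n≤b^[2+n] : ∀ {b} n → 2 ≤ b → suc (suc b * b ^ n) ≤ b ^ (2 + n)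
1+[1+b]b^n≤b^[2+n] {b@(suc _)} n 2≤b = begin
  1 + suc b * b ^ n       ≤⟨ +-monoˡ-≤ _ (m^n>0 b n) ⟩
  b ^ n + suc b * b ^ n   ≡⟨⟩
  (2 + b) * b ^ n         ≤⟨ *-monoˡ-≤ (b ^ n) (2+n≤n*n 2≤b) ⟩
  b * b * b ^ n           ≡⟨ *-assoc b b (b ^ n) ⟩
  b ^ (2 + n)             ∎
  where open ≤-Reasoning

^≤repunit : ∀ g k → g ^ k ≤ repunit g (suc k)
^≤repunit g k = m≤m+n (g ^ k) (repunit g k)

x^k≤y^j⇒x^[e*k]≤y^[e*j] : ∀ {x y} e k j → x ^ k ≤ y ^ j → x ^ (e * k) ≤ y ^ (e * j)
x^k≤y^j⇒x^[e*k]≤y^[e*j] {x} {y} e k j x^k≤y^j = begin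
  x ^ (e * k)   ≡⟨ cong (x ^_) (*-comm e k) ⟩
  x ^ (k * e)   ≡⟨ sym (^-*-assoc x k e) ⟩
  (x ^ k) ^ e   ≤⟨ ^-monoˡ-≤ e x^k≤y^j ⟩
  (y ^ j) ^ e   ≡⟨ ^-*-assoc y j e ⟩
  y ^ (j * e)   ≡⟨ cong (y ^_) (*-comm j e) ⟩
  y ^ (e * j)   ∎
  where open ≤-Reasoning

100*[2+n]<130*n+208 : ∀ n → 100 * (2 + n) < 130 * n + 208
100*[2+n]<130*n+208 n = begin-strict
  100 * (2 + n)   ≡⟨ solve 1 (λ n → con 100 :* (con 2 :+ n) := con 100 :* n :+ con 200) refl n ⟩
  100 * n + 200   <⟨ +-mono-≤-< (*-monoˡ-≤ n (m≤m+n 100 30)) (m≤m+n 201 7) ⟩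
  130 * n + 208   ∎
  where open ≤-Reasoning

lemma6 : (b g d₁ d₂ l m n : ℕ) → 2 ≤ b → 3 ≤ g →
         1 ≤ d₁ → d₁ ≤ g ∸ 1 → 1 ≤ d₂ → d₂ ≤ g ∸ 1 → 1 ≤ l → l ≤ m →
         (s₁ s₂ : ℤ) → (s₁ ≡ + 1 ⊎ s₁ ≡ -[1+ 0 ]) → (s₂ ≡ + 1 ⊎ s₂ ≡ -[1+ 0 ]) →
         ((+ b +ℤ s₁) *ℤ ((+ b) ^ℤ n)) +ℤ s₂ ≡ + (d₁ * repunit g l + d₂ * repunit g m) →
         l ≤ m × g ^ (100 * (m ∸ 1)) < b ^ (130 * n + 208)
lemma6 b g d₁ d₂@(suc _) l@(suc _) (suc k) n 2≤b _ _ _ _ _ _ l≤m@(s≤s _) _ _ σ₁ σ₂ eq = l≤m , (begin-strict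
  g ^ (100 * k)          ≤⟨ x^k≤y^j⇒x^[e*k]≤y^[e*j] {g} {b} 100 k (2 + n) g^k≤b^[2+n] ⟩
  b ^ (100 * (2 + n))    <⟨ ^-monoʳ-< b 2≤b (100*[2+n]<130*n+208 n) ⟩
  b ^ (130 * n + 208)    ∎)
  where
  open ≤-Reasoning
  g^k≤b^[2+n] : g ^ k ≤ b ^ (2 + n)
  g^k≤b^[2+n] = begin
    g ^ k                                  ≤⟨ ^≤repunit g k ⟩
    repunit g (suc k)                      ≤⟨ m≤n*m _ d₂ ⟩
    d₂ * repunit g (suc k)                 ≤⟨ m≤n+m _ (d₁ * repunit g l) ⟩
    d₁ * repunit g l + d₂ * repunit g (suc k)
                                           ≤⟨ [b±1]b^n±1≡v⇒v≤1+[1+b]b^n n (<⇒≤ 2≤b) σ₁ σ₂ eq ⟩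
    suc (suc b * b ^ n)                    ≤⟨ 1+[1+b]b^n≤b^[2+n] n 2≤b ⟩
    b ^ (2 + n)                            ∎
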